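{- Let $n,d$ be positive integers with $dn$ even, let $I\subseteq[n]$ with $|I|=t$, and for each integer $k$ let $\mathcal{C}_{T_I,k}$ be the set of pairings in $\mathcal{P}_{n,d}$ having exactly $k$ pairs both of whose elements lie in $T_I$. Then $|\mathcal{C}_{T_I,k}|$ is monotonically increasing as $k$ goes from $\max\{0,dt-\frac{dn}{2}\}$ to $\lfloor \mathbb{E}[X_{T_I}]\rfloor$, and monotonically decreasing as $k$ goes from $\lceil \mathbb{E}[X_{T_I}]\rceil$ to $\frac{dt}{2}$, where $\mathbb{E}[X_{T_I}]=\binom{dt}{2}\frac{1}{dn-1}$.
   Context: Configuration model: take $dn$ elements $e_1,\dots,e_{dn}$ partitioned into $n$ cells $c_i=\{e_j: d(i-1)+1\le j\le di\}$, $1\le i\le n$. A pairing is a perfect matching of these $dn$ elements into $dn/2$ pairs; $\mathcal{P}_{n,d}$ is the uniform probability space on all pairings. For $I\subseteq[n]$, $T_I=\bigcup_{i\in I}c_i$, and $X_{T_I}(P)$ is the number of pairs of the pairing $P$ that use only elements of $T_I$; its expectation is $\binom{dt}{2}\frac{1}{dn-1}$ when $|I|=t$. -}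

module Defs where

open import Data.Nat using (ℕ; zero; suc; _+_; _*_; _∸_; _≤_; _<_; _<?_; _≤?_)
open import Data.Nat.Combinatorics using (_C_)
open import Data.Nat.DivMod using (_/_)
open import Data.Fin using (Fin; toℕ)
open import Data.Fin.Properties using (any?; all?; _≟_)
open import Data.Fin.Subset using (Subset; _∈_)
open import Data.Fin.Subset.Properties using (_∈?_)
open import Data.Vec using (Vec; []; _∷_; lookup)
open import Data.List using (List; []; _∷_; concatMap; map; filter; length)
open import Data.Product using (Σ; _×_; _,_)
open import Data.Product.Properties using ()
open import Relation.Nullary using (¬_; Dec)
open import Relation.Nullary.Decidable using (_×-dec_; ¬?)
open import Relation.Binary.PropositionalEquality using (_≡_; _≢_)

allVecs : (m k : ℕ) → List (Vec (Fin k) m)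
allVecs zero    k = [] ∷ []
allVecs (suc m) k = concatMap (λ v → map (_∷ v) (allFins k)) (allVecs m k)
  where
  open import Data.List using (allFin)
  allFins : (k : ℕ) → List (Fin k)
  allFins k = allFin k

-- A pairing of the elements Fin m (perfect matching) is encoded as its
-- partner map p, which must be a fixed-point-free involution.
IsPairing : {m : ℕ} → (Fin m → Fin m) → Set
IsPairing {m} p = (i : Fin m) → (p (p i) ≡ i) × (p i ≢ i)

isPairing? : {m : ℕ} → (p : Fin m → Fin m) → Dec (IsPairing p)
isPairing? p = all? (λ i → (p (p i) ≟ i) ×-dec ¬? (p i ≟ i))

pairings : (m : ℕ) → List (Vec (Fin m) m)
pairings m = filter (λ v → isPairing? (lookup v)) (allVecs m m)

-- Element j (0-indexed) lies in cell i (0-indexed) iff d*i ≤ j < d*(i+1).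
InCell : (d : ℕ) → ℕ → ℕ → Set
InCell d i j = (d * i ≤ j) × (j < d * suc i)

InT : (d n : ℕ) → Subset n → Fin (d * n) → Set
InT d n I j = Σ (Fin n) λ i → (i ∈ I) × InCell d (toℕ i) (toℕ j)

inT? : (d n : ℕ) → (I : Subset n) → (j : Fin (d * n)) → Dec (InT d n I j)
inT? d n I j = any? (λ i → (i ∈? I) ×-dec ((d * toℕ i ≤? toℕ j) ×-dec (toℕ j <? d * suc (toℕ i))))

-- X_{T_I}(P): number of pairs {j, p j} with both elements in T_I
-- (each pair counted once, via its smaller element j < p j).
X : (d n : ℕ) → Subset n → (Fin (d * n) → Fin (d * n)) → ℕ
X d n I p = length (filter (λ j → inT? d n I j ×-dec (inT? d n I (p j) ×-dec (toℕ j <? toℕ (p j)))) (allFin (d * n)))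
  where open import Data.List using (allFin)

cardC : (d n : ℕ) → Subset n → ℕ → ℕ
cardC d n I k = length (filter (λ v → Data.Nat._≟_ (X d n I (lookup v)) k) (pairings (d * n)))
  where import Data.Nat

-- ⌊E[X_T]⌋ and ⌈E[X_T]⌉ where E[X_T] = C(dt,2)/(dn-1).
-- Under the hypothesis dn ≥ 2 (dn even and positive), dn - 1 = suc (dn - 2).
floorE : (d n t : ℕ) → ℕ
floorE d n t = ((d * t) C 2) / suc (d * n ∸ 2)

ceilE : (d n t : ℕ) → ℕ
ceilE d n t = (((d * t) C 2) + (d * n ∸ 2)) / suc (d * n ∸ 2)

-- Mark the s = d|I| points of T_I among the N = dn points. The number of pairings with exactly
-- k marked pairs depends only on (s, b, k), b = N − s: matching a marked point with one of the
-- other points gives a recurrence, whose solution is s! b! / (u! (2k)!! (2j)!!), where u = s − 2k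
-- is the number of mixed pairs and j = (b − u)/2 the number of unmarked ones. Going from k to
-- k + 1 multiplies it by u(u − 1) / (4(k + 1)(j + 1)), and
--   s(s − 1) − 2(k + 1)(N − 1) ≤ u(u − 1) − 4(k + 1)(j + 1) ≤ s(s − 1) − 2k(N − 1),
-- so E[X] = C(s,2)/(N − 1) ≥ k + 1 makes the ratio at least 1 and E[X] ≤ k makes it at most 1.
-- That j ≥ 0 follows from k ≥ s − N/2 in the first case and from E[X] ≤ k in the second.

module Submission where

open import Defs
open import Data.Nat using (ℕ; suc; _+_; _*_; _∸_; _≤_; _<_)
open import Data.Nat.DivMod using (_/_)
open import Data.Nat.Divisibility using (_∣_)
open import Data.Fin.Subset using (Subset; ∣_∣)
open import Data.Product using (_×_)

open import Data.Bool using (Bool; true; false; _∧_; _∨_; not; if_then_else_)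
open import Data.Bool.Properties using (∧-zeroʳ; ∧-identityʳ; ∨-identityʳ; ¬-not)
open import Data.Empty using (⊥-elim)
open import Data.Fin as Fin using (Fin; zero; suc; toℕ; punchIn; punchOut)
open import Data.Fin.Properties
  using (any?; punchIn-injective; punchInᵢ≢i; punchIn-punchOut; punchIn-mono-≤; punchIn-cancel-≤; toℕ-injective)
open import Data.Fin.Subset using () renaming (_∈_ to _∈ˢ_)
open import Data.Fin.Subset.Properties using (_∈?_; ∣p∣≤n)
open import Data.List using (List; []; _∷_; length; filter; map; allFin; _++_; concatMap; tabulate)
open import Data.List.Properties using (length-++)
open import Data.List.Membership.Propositional using (_∈_)
open import Data.List.Membership.Propositional.Properties
  using (∈-∃++; ∈-++⁻; ∈-++⁺ˡ; ∈-++⁺ʳ; ∈-filter⁺; ∈-filter⁻; ∈-concatMap⁺; ∈-concatMap⁻)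
open import Data.List.Membership.Propositional.Properties using (∈-map⁺; ∈-map⁻; ∈-allFin)
open import Data.List.Relation.Unary.All as All using (All; []; _∷_)
open import Data.List.Relation.Unary.All.Properties using (all-filter)
open import Data.List.Relation.Unary.AllPairs using ([]; _∷_)
open import Data.List.Relation.Unary.Any as Any using (here; there)
open import Data.List.Relation.Unary.Unique.Propositional using (Unique)
import Data.List.Relation.Unary.Unique.Propositional.Properties as Unique
open import Data.Nat as ℕ using (zero; pred; z≤n; s≤s; NonZero; >-nonZero; _!)
open import Data.Nat.Combinatorics using (_C_; nC1≡n; nCk+nC[k+1]≡[n+1]C[k+1])
open import Data.Nat.DivMod using (m/n*n≤m; m*n/n≡m; /-monoˡ-≤; /-congˡ)
open import Data.Nat.Divisibility using (divides)
open import Data.Nat.Properties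
open import Algebra.Properties.Semiring.Sum +-*-semiring
  using (sum; sum-cong-≗; sum-remove; sum-replicate-zero; ∑-distrib-+; *-distribˡ-sum)
open import Data.Nat.Tactic.RingSolver using (solve-∀)
open import Data.Product using (Σ; ∃; _,_; proj₁; proj₂)
open import Data.Sum using (inj₁; inj₂)
open import Data.Vec as Vec using (Vec; []; _∷_; lookup; tail)
import Data.Vec.Properties as Vecₚ
open import Function using (_∘_)
open import Function.Bundles using (mk⇔)
open import Relation.Binary using (tri<; tri≈; tri>)
open import Relation.Binary.PropositionalEquality
open import Relation.Nullary using (Dec; yes; no; does; ¬_)
open import Relation.Nullary.Decidable using (_×-dec_; dec-true; dec-false; does-⇔)
open import Relation.Unary using (Decidable)

fromBool : Bool → ℕ
fromBool true  = 1
fromBool false = 0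

fromBool-∧ : ∀ a b → fromBool (a ∧ b) ≡ fromBool a * fromBool b
fromBool-∧ true  b = sym (+-identityʳ (fromBool b))
fromBool-∧ false b = refl

_==_ : ∀ {n} → Fin n → Fin n → Bool
x == y = does (x Fin.≟ y)

sum-== : ∀ {n} (y : Fin n) → sum (λ x → fromBool (y == x)) ≡ 1
sum-== {suc n} zero    = cong suc (sum-replicate-zero n)
sum-== {suc n} (suc y) = sum-== y

size : ∀ {n} → (Fin n → Bool) → ℕ
size S = sum (fromBool ∘ S)

size-remove : ∀ {n} (S : Fin (suc n) → Bool) a → size S ≡ fromBool (S a) + size (S ∘ punchIn a)
size-remove S a = sum-remove {i = a} (fromBool ∘ S)

size+size-not : ∀ n (S : Fin n → Bool) → size S + size (not ∘ S) ≡ n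
size+size-not zero    S = refl
size+size-not (suc n) S with S zero
... | true  = cong suc (size+size-not n (S ∘ suc))
... | false = trans (+-suc _ _) (cong suc (size+size-not n (S ∘ suc)))

size-allFalse : ∀ n (S : Fin n → Bool) → (∀ x → S x ≡ false) → size S ≡ 0
size-allFalse n S allFalse = trans (sum-cong-≗ {n} (cong fromBool ∘ allFalse)) (sum-replicate-zero n)

sum-const : ∀ n x → sum {n} (λ _ → x) ≡ n * x
sum-const zero    x = refl
sum-const (suc n) x = cong (x +_) (sum-const n x)

sum-if : ∀ n (S : Fin n → Bool) x y → sum (λ i → if S i then x else y) ≡ size S * x + size (not ∘ S) * y
sum-if zero    S x y = refl
sum-if (suc n) S x y with S zero
... | true  rewrite sum-if n (S ∘ suc) x y = sym (+-assoc x _ _)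
... | false rewrite sum-if n (S ∘ suc) x y = +-comm-middle y (size (S ∘ suc) * x) (size (not ∘ S ∘ suc) * y)
  where
  +-comm-middle : ∀ a b c → a + (b + c) ≡ b + (a + c)
  +-comm-middle = solve-∀

module _ {a} {A : Set a} where

  count : {P : A → Set} → Decidable P → List A → ℕ
  count P? []       = 0
  count P? (x ∷ xs) = fromBool (does (P? x)) + count P? xs

  count-cong : ∀ {P Q : A → Set} (P? : Decidable P) (Q? : Decidable Q) xs →
    (∀ x → does (P? x) ≡ does (Q? x)) → count P? xs ≡ count Q? xs
  count-cong P? Q? []       eq = refl
  count-cong P? Q? (x ∷ xs) eq = cong₂ _+_ (cong fromBool (eq x)) (count-cong P? Q? xs eq)

  count-none : ∀ {P : A → Set} (P? : Decidable P) xs → (∀ x → ¬ P x) → count P? xs ≡ 0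
  count-none P? []       ¬P = refl
  count-none P? (x ∷ xs) ¬P rewrite dec-false (P? x) (¬P x) = count-none P? xs ¬P

  length-filter≡count : ∀ {P : A → Set} (P? : Decidable P) xs → length (filter P? xs) ≡ count P? xs
  length-filter≡count P? [] = refl
  length-filter≡count P? (x ∷ xs) with does (P? x)
  ... | true  = cong suc (length-filter≡count P? xs)
  ... | false = length-filter≡count P? xs

  length-filter-filter≡count : ∀ {P Q : A → Set} (P? : Decidable P) (Q? : Decidable Q) xs →
    length (filter Q? (filter P? xs)) ≡ count (λ x → P? x ×-dec Q? x) xs
  length-filter-filter≡count P? Q? [] = refl
  length-filter-filter≡count P? Q? (x ∷ xs) with does (P? x)
  ... | false = length-filter-filter≡count P? Q? xs
  ... | true with does (Q? x)
  ...   | true  = cong suc (length-filter-filter≡count P? Q? xs)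
  ...   | false = length-filter-filter≡count P? Q? xs

  count-partition : ∀ n (h : A → Fin n) {P : A → Set} (P? : Decidable P) xs →
    count P? xs ≡ sum (λ c → count (λ x → P? x ×-dec h x Fin.≟ c) xs)
  count-partition n h P? []       = sym (sum-replicate-zero n)
  count-partition n h P? (x ∷ xs) = begin
      fromBool (does (P? x)) + count P? xs
    ≡⟨ cong₂ _+_ (sym split-x) (count-partition n h P? xs) ⟩
      sum (λ c → fromBool (does (P? x) ∧ (h x == c))) + sum (λ c → count (λ x → P? x ×-dec h x Fin.≟ c) xs)
    ≡⟨ ∑-distrib-+ {n} _ _ ⟨
      sum (λ c → count (λ x → P? x ×-dec h x Fin.≟ c) (x ∷ xs))
    ∎
    where
    open ≡-Reasoning
    px = fromBool (does (P? x))
    split-x : sum (λ c → fromBool (does (P? x) ∧ (h x == c))) ≡ px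
    split-x = begin
        sum (λ c → fromBool (does (P? x) ∧ (h x == c)))  ≡⟨ sum-cong-≗ {n} (fromBool-∧ (does (P? x)) ∘ (h x ==_)) ⟩
        sum (λ c → px * fromBool (h x == c))              ≡⟨ *-distribˡ-sum {n} px _ ⟨
        px * sum (λ c → fromBool (h x == c))              ≡⟨ cong (px *_) (sum-== (h x)) ⟩
        px * 1                                            ≡⟨ *-identityʳ px ⟩
        px                                                ∎

count-tabulate : ∀ {a} {A : Set a} n (f : Fin n → A) {P : A → Set} (P? : Decidable P) →
  count P? (tabulate f) ≡ sum (λ i → fromBool (does (P? (f i))))
count-tabulate zero    f P? = refl
count-tabulate (suc n) f P? = cong (fromBool (does (P? (f zero))) +_) (count-tabulate n (f ∘ suc) P?)

count-allFin : ∀ n {P : Fin n → Set} (P? : Decidable P) → count P? (allFin n) ≡ sum (λ i → fromBool (does (P? i)))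
count-allFin n = count-tabulate n (λ i → i)

module _ {a b} {A : Set a} {B : Set b} where

  length-≤-injection : ∀ {P : A → Set} (f : A → B) xs ys → Unique xs → All P xs →
    (∀ {x y} → P x → P y → f x ≡ f y → x ≡ y) → (∀ {x} → x ∈ xs → f x ∈ ys) →
    length xs ≤ length ys
  length-≤-injection f []       ys _          _          inj into = z≤n
  length-≤-injection f (x ∷ xs) ys (x∉ ∷ uxs) (px ∷ pxs) inj into with ∈-∃++ (into (here refl))
  ... | ys₁ , ys₂ , refl = begin
      suc (length xs)               ≤⟨ s≤s (length-≤-injection f xs (ys₁ ++ ys₂) uxs pxs inj into′) ⟩
      suc (length (ys₁ ++ ys₂))     ≡⟨ cong suc (length-++ ys₁) ⟩
      suc (length ys₁ + length ys₂) ≡⟨ +-suc (length ys₁) (length ys₂) ⟨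
      length ys₁ + suc (length ys₂) ≡⟨ length-++ ys₁ ⟨
      length (ys₁ ++ f x ∷ ys₂)     ∎
    where
    open ≤-Reasoning
    into′ : ∀ {w} → w ∈ xs → f w ∈ ys₁ ++ ys₂
    into′ {w} w∈xs with ∈-++⁻ ys₁ (into (there w∈xs))
    ... | inj₁ ∈ys₁        = ∈-++⁺ˡ ∈ys₁
    ... | inj₂ (here fw≡fx) = ⊥-elim (All.lookup x∉ w∈xs (sym (inj (All.lookup pxs w∈xs) px fw≡fx)))
    ... | inj₂ (there ∈ys₂) = ∈-++⁺ʳ ys₁ ∈ys₂

  count-≤-injection : ∀ {P : A → Set} {Q : B → Set} (P? : Decidable P) (Q? : Decidable Q) (f : A → B) xs ys →
    Unique xs → (∀ y → y ∈ ys) → (∀ {x} → P x → Q (f x)) →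
    (∀ {x y} → P x → P y → f x ≡ f y → x ≡ y) → count P? xs ≤ count Q? ys
  count-≤-injection P? Q? f xs ys uxs complete pres inj =
    subst₂ _≤_ (length-filter≡count P? xs) (length-filter≡count Q? ys)
      (length-≤-injection f (filter P? xs) (filter Q? ys) (Unique.filter⁺ P? uxs) (all-filter P? xs) inj
        (λ {x} x∈ → ∈-filter⁺ Q? (complete (f x)) (pres (proj₂ (∈-filter⁻ P? {xs = xs} x∈)))))

count-≡-bijection : ∀ {a b} {A : Set a} {B : Set b} {P : A → Set} {Q : B → Set} (P? : Decidable P) (Q? : Decidable Q)
  (f : A → B) (g : B → A) xs ys → Unique xs → Unique ys → (∀ x → x ∈ xs) → (∀ y → y ∈ ys) →
  (∀ {x} → P x → Q (f x)) → (∀ {y} → Q y → P (g y)) →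
  (∀ {x} → P x → g (f x) ≡ x) → (∀ {y} → Q y → f (g y) ≡ y) →
  count P? xs ≡ count Q? ys
count-≡-bijection P? Q? f g xs ys uxs uys all-xs all-ys pf qg gf fg = ≤-antisym
  (count-≤-injection P? Q? f xs ys uxs all-ys pf λ px py eq → trans (sym (gf px)) (trans (cong g eq) (gf py)))
  (count-≤-injection Q? P? g ys xs uys all-xs qg λ qx qy eq → trans (sym (fg qx)) (trans (cong f eq) (fg qy)))

allVecs-complete : ∀ m k (v : Vec (Fin k) m) → v ∈ allVecs m k
allVecs-complete zero    k []      = here refl
allVecs-complete (suc m) k (x ∷ v) =
  ∈-concatMap⁺ (λ w → map (_∷ w) (allFin k))
    (Any.map (λ { refl → ∈-map⁺ (_∷ v) (∈-allFin x) }) (allVecs-complete m k v))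

allVecs-unique : ∀ m k → Unique (allVecs m k)
allVecs-unique zero    k = [] ∷ []
allVecs-unique (suc m) k = extend-unique (allVecs m k) (allVecs-unique m k)
  where
  extensions : Vec (Fin k) m → List (Vec (Fin k) (suc m))
  extensions w = map (_∷ w) (allFin k)
  tail∈ : ∀ {v} ws → v ∈ concatMap extensions ws → tail v ∈ ws
  tail∈ ws v∈ = Any.map (λ {w} v∈ext → cong tail (proj₂ (proj₂ (∈-map⁻ (_∷ w) v∈ext))))
                        (∈-concatMap⁻ extensions {xs = ws} v∈)
  extend-unique : ∀ ws → Unique ws → Unique (concatMap extensions ws)
  extend-unique []       _          = []
  extend-unique (w ∷ ws) (w∉ ∷ uws) =
    Unique.++⁺ (Unique.map⁺ (λ eq → proj₁ (Vecₚ.∷-injective eq)) (Unique.allFin⁺ k)) (extend-unique ws uws)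
      λ { (v∈₁ , v∈₂) → All.lookup w∉ (tail∈ ws v∈₂)
                          (sym (cong tail (proj₂ (proj₂ (∈-map⁻ (_∷ w) v∈₁))))) }

lookup-ext : ∀ {a} {A : Set a} {n} (u v : Vec A n) → (∀ i → lookup u i ≡ lookup v i) → u ≡ v
lookup-ext u v eq = trans (sym (Vecₚ.tabulate∘lookup u)) (trans (Vecₚ.tabulate-cong eq) (Vecₚ.tabulate∘lookup v))

_<ᵇ_ : ∀ {m} → Fin m → Fin m → Bool
x <ᵇ y = does (toℕ x <? toℕ y)

<ᵇ-exclusive : ∀ {m} (x y : Fin m) → x ≢ y → fromBool (x <ᵇ y) + fromBool (y <ᵇ x) ≡ 1
<ᵇ-exclusive x y x≢y with <-cmp (toℕ x) (toℕ y)
... | tri< x<y _ y≮x rewrite dec-true (toℕ x <? toℕ y) x<y | dec-false (toℕ y <? toℕ x) y≮x = refl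
... | tri≈ _ x≡y _   = ⊥-elim (x≢y (toℕ-injective x≡y))
... | tri> x≮y _ y<x rewrite dec-false (toℕ x <? toℕ y) x≮y | dec-true (toℕ y <? toℕ x) y<x = refl

punchIn-<ᵇ : ∀ {m} (a : Fin (suc m)) (i j : Fin m) → punchIn a i <ᵇ punchIn a j ≡ i <ᵇ j
punchIn-<ᵇ a i j = does-⇔ (mk⇔ cancel mono) (toℕ (punchIn a i) <? toℕ (punchIn a j)) (toℕ i <? toℕ j)
  where
  cancel : toℕ (punchIn a i) < toℕ (punchIn a j) → toℕ i < toℕ j
  cancel lt = ≤∧≢⇒< (punchIn-cancel-≤ a i j (<⇒≤ lt))
                    λ eq → <⇒≢ lt (cong (toℕ ∘ punchIn a) (toℕ-injective eq))
  mono : toℕ i < toℕ j → toℕ (punchIn a i) < toℕ (punchIn a j)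
  mono lt = ≤∧≢⇒< (punchIn-mono-≤ a i j (<⇒≤ lt))
                  λ eq → <⇒≢ lt (cong toℕ (punchIn-injective a i j (toℕ-injective eq)))

innerPairs : ∀ {m} → (Fin m → Bool) → (Fin m → Fin m) → ℕ
innerPairs S p = sum (λ j → fromBool (S j ∧ (S (p j) ∧ j <ᵇ p j)))

PairingWith : ∀ {m} → ℕ → (Fin m → Bool) → ℕ → Vec (Fin m) m → Set
PairingWith δ S k v = IsPairing (lookup v) × δ + innerPairs S (lookup v) ≡ k

pairingWith? : ∀ {m} δ (S : Fin m → Bool) k → Decidable (PairingWith δ S k)
pairingWith? δ S k v = isPairing? (lookup v) ×-dec δ + innerPairs S (lookup v) ℕ.≟ k

pairingCountFrom : ∀ m → ℕ → (Fin m → Bool) → ℕ → ℕ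
pairingCountFrom m δ S k = count (pairingWith? δ S k) (allVecs m m)

pairingCount : ∀ m → (Fin m → Bool) → ℕ → ℕ
pairingCount m = pairingCountFrom m 0

-- Removing the pair of a point

module RemovePair (m : ℕ) (a : Fin (suc (suc m))) (c′ : Fin (suc m)) where

  c : Fin (suc (suc m))
  c = punchIn a c′

  embed : Fin m → Fin (suc (suc m))
  embed i = punchIn a (punchIn c′ i)

  c≢a : c ≢ a
  c≢a = punchInᵢ≢i a c′

  embed≢a : ∀ i → embed i ≢ a
  embed≢a i = punchInᵢ≢i a _

  embed≢c : ∀ i → embed i ≢ c
  embed≢c i eq = punchInᵢ≢i c′ i (punchIn-injective a _ _ eq)

  embed-injective : ∀ i j → embed i ≡ embed j → i ≡ j
  embed-injective i j eq = punchIn-injective c′ i j (punchIn-injective a _ _ eq)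

  data Position (x : Fin (suc (suc m))) : Set where
    at-a     : x ≡ a → Position x
    at-c     : x ≡ c → Position x
    at-embed : (i : Fin m) → x ≡ embed i → Position x

  position : ∀ x → Position x
  position x with a Fin.≟ x
  ... | yes a≡x = at-a (sym a≡x)
  ... | no a≢x with c′ Fin.≟ punchOut a≢x
  ...   | yes c′≡ = at-c (trans (sym (punchIn-punchOut a≢x)) (cong (punchIn a) (sym c′≡)))
  ...   | no c′≢  = at-embed (punchOut c′≢)
                      (trans (sym (punchIn-punchOut a≢x)) (cong (punchIn a) (sym (punchIn-punchOut c′≢))))

  module _ {B : Set} (onA onC : B) (onEmbed : Fin m → B) where

    caseOn : ∀ {x} → Position x → B
    caseOn (at-a _)       = onA
    caseOn (at-c _)       = onC
    caseOn (at-embed i _) = onEmbed i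

    caseOn-irrelevant : ∀ {x} (p q : Position x) → caseOn p ≡ caseOn q
    caseOn-irrelevant (at-a _)       (at-a _)       = refl
    caseOn-irrelevant (at-a refl)    (at-c x≡c)     = ⊥-elim (c≢a (sym x≡c))
    caseOn-irrelevant (at-a refl)    (at-embed i e) = ⊥-elim (embed≢a i (sym e))
    caseOn-irrelevant (at-c refl)    (at-a x≡a)     = ⊥-elim (c≢a x≡a)
    caseOn-irrelevant (at-c _)       (at-c _)       = refl
    caseOn-irrelevant (at-c refl)    (at-embed i e) = ⊥-elim (embed≢c i (sym e))
    caseOn-irrelevant (at-embed i e) (at-a x≡a)     = ⊥-elim (embed≢a i (trans (sym e) x≡a))
    caseOn-irrelevant (at-embed i e) (at-c x≡c)     = ⊥-elim (embed≢c i (trans (sym e) x≡c))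
    caseOn-irrelevant (at-embed i e) (at-embed j f) = cong onEmbed (embed-injective i j (trans (sym e) f))

    caseOn-position : ∀ {x} (p : Position x) → caseOn (position x) ≡ caseOn p
    caseOn-position p = caseOn-irrelevant (position _) p

  restrictAt : Vec (Fin (suc (suc m))) (suc (suc m)) → Fin m → Fin m
  restrictAt v i = caseOn i i (λ j → j) (position (lookup v (embed i)))

  restrict : Vec (Fin (suc (suc m))) (suc (suc m)) → Vec (Fin m) m
  restrict v = Vec.tabulate (restrictAt v)

  extendAt : Vec (Fin m) m → Fin (suc (suc m)) → Fin (suc (suc m))
  extendAt w x = caseOn c a (embed ∘ lookup w) (position x)

  extend : Vec (Fin m) m → Vec (Fin (suc (suc m))) (suc (suc m))
  extend w = Vec.tabulate (extendAt w)

  module _ (w : Vec (Fin m) m) where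

    private
      R = lookup (extend w)

    lookup-extend : ∀ {x} (p : Position x) → R x ≡ caseOn c a (embed ∘ lookup w) p
    lookup-extend {x} p = trans (Vecₚ.lookup∘tabulate (extendAt w) x) (caseOn-position c a (embed ∘ lookup w) p)

    extend-a : R a ≡ c
    extend-a = lookup-extend (at-a refl)

    extend-c : R c ≡ a
    extend-c = lookup-extend (at-c refl)

    extend-embed : ∀ i → R (embed i) ≡ embed (lookup w i)
    extend-embed i = lookup-extend (at-embed i refl)

    restrict-extend : restrict (extend w) ≡ w
    restrict-extend = lookup-ext _ w λ i →
      trans (Vecₚ.lookup∘tabulate (restrictAt (extend w)) i)
            (caseOn-position i i (λ j → j) (at-embed (lookup w i) (extend-embed i)))

    extend-isPairing : IsPairing (lookup w) → IsPairing R
    extend-isPairing w-pairing x = go (position x)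
      where
      go : Position x → (R (R x) ≡ x) × (R x ≢ x)
      go (at-a refl)       = trans (cong R extend-a) extend-c , λ eq → c≢a (trans (sym extend-a) eq)
      go (at-c refl)       = trans (cong R extend-c) extend-a , λ eq → c≢a (sym (trans (sym extend-c) eq))
      go (at-embed i refl) = trans (cong R (extend-embed i)) (trans (extend-embed _) (cong embed (proj₁ (w-pairing i))))
                           , λ eq → proj₂ (w-pairing i) (embed-injective _ _ (trans (sym (extend-embed i)) eq))

  module _ (v : Vec (Fin (suc (suc m))) (suc (suc m))) (v-pairing : IsPairing (lookup v)) (v-a : lookup v a ≡ c) where

    private
      P = lookup v

    v-c : P c ≡ a
    v-c = trans (cong P (sym v-a)) (proj₁ (v-pairing a))

    restrict-embed : ∀ i → P (embed i) ≡ embed (lookup (restrict v) i)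
    restrict-embed i with position (P (embed i)) in eq
    ... | at-a Pe≡a = ⊥-elim (embed≢c i (trans (sym (proj₁ (v-pairing (embed i)))) (trans (cong P Pe≡a) v-a)))
    ... | at-c Pe≡c = ⊥-elim (embed≢a i (trans (sym (proj₁ (v-pairing (embed i)))) (trans (cong P Pe≡c) v-c)))
    ... | at-embed j Pe≡ej =
      trans Pe≡ej (cong embed (sym (trans (Vecₚ.lookup∘tabulate (restrictAt v) i) (cong (caseOn i i (λ j → j)) eq))))

    restrict-isPairing : IsPairing (lookup (restrict v))
    restrict-isPairing i =
        embed-injective _ _ (trans (sym (restrict-embed _))
                              (trans (cong P (sym (restrict-embed i))) (proj₁ (v-pairing (embed i)))))
      , λ eq → proj₂ (v-pairing (embed i)) (trans (restrict-embed i) (cong embed eq))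

    extend-restrict : extend (restrict v) ≡ v
    extend-restrict = lookup-ext _ v λ x → go (position x)
      where
      go : ∀ {x} → Position x → lookup (extend (restrict v)) x ≡ P x
      go (at-a refl)       = trans (extend-a (restrict v)) (sym v-a)
      go (at-c refl)       = trans (extend-c (restrict v)) (sym v-c)
      go (at-embed i refl) = trans (extend-embed (restrict v) i) (sym (restrict-embed i))

  innerPairs-restrict : ∀ (S : Fin (suc (suc m)) → Bool) v → IsPairing (lookup v) → lookup v a ≡ c →
    innerPairs S (lookup v) ≡ fromBool (S a ∧ S c) + innerPairs (S ∘ embed) (lookup (restrict v))
  innerPairs-restrict S v v-pairing v-a = begin
      sum t                                   ≡⟨ sum-remove {i = a} t ⟩
      t a + sum (t ∘ punchIn a)               ≡⟨ cong (t a +_) (sum-remove {i = c′} (t ∘ punchIn a)) ⟩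
      t a + (t c + sum (t ∘ embed))           ≡⟨ +-assoc (t a) (t c) _ ⟨
      (t a + t c) + sum (t ∘ embed)           ≡⟨ cong₂ _+_ pair-a-c (sum-cong-≗ {m} t-embed) ⟩
      fromBool (S a ∧ S c) + innerPairs (S ∘ embed) Q ∎
    where
    open ≡-Reasoning
    P = lookup v
    Q = lookup (restrict v)
    t : Fin (suc (suc m)) → ℕ
    t x = fromBool (S x ∧ (S (P x) ∧ x <ᵇ P x))
    pair-a-c : t a + t c ≡ fromBool (S a ∧ S c)
    pair-a-c rewrite v-a | v-c v v-pairing v-a = exactlyOne (S a) (S c) (<ᵇ-exclusive a c (c≢a ∘ sym))
      where
      exactlyOne : ∀ sa sc {l l′} → fromBool l + fromBool l′ ≡ 1 →
        fromBool (sa ∧ (sc ∧ l)) + fromBool (sc ∧ (sa ∧ l′)) ≡ fromBool (sa ∧ sc)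
      exactlyOne true  true  l+l′≡1 = l+l′≡1
      exactlyOne true  false _      = refl
      exactlyOne false true  _      = refl
      exactlyOne false false _      = refl
    t-embed : ∀ i → t (embed i) ≡ fromBool (S (embed i) ∧ (S (embed (Q i)) ∧ i <ᵇ Q i))
    t-embed i rewrite restrict-embed v v-pairing v-a i
                    | punchIn-<ᵇ a (punchIn c′ i) (punchIn c′ (Q i)) | punchIn-<ᵇ c′ i (Q i) = refl

  pairingCount-partner : ∀ (S : Fin (suc (suc m)) → Bool) k →
    count (λ v → pairingWith? 0 S k v ×-dec lookup v a Fin.≟ c) (allVecs (suc (suc m)) (suc (suc m)))
    ≡ pairingCountFrom m (fromBool (S a ∧ S c)) (S ∘ embed) k
  pairingCount-partner S k =
    count-≡-bijection
      (λ v → pairingWith? 0 S k v ×-dec lookup v a Fin.≟ c) (pairingWith? (fromBool (S a ∧ S c)) (S ∘ embed) k)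
      restrict extend _ _ (allVecs-unique _ _) (allVecs-unique m m)
      (allVecs-complete _ _) (allVecs-complete m m) (λ {v} → forth {v}) (λ {w} → back {w})
      (λ {v} ((v-pairing , _) , v-a) → extend-restrict v v-pairing v-a)
      (λ {w} _ → restrict-extend w)
    where
    δ = fromBool (S a ∧ S c)
    forth : ∀ {v} → PairingWith 0 S k v × lookup v a ≡ c → PairingWith δ (S ∘ embed) k (restrict v)
    forth {v} ((v-pairing , inner≡k) , v-a) =
      restrict-isPairing v v-pairing v-a , trans (sym (innerPairs-restrict S v v-pairing v-a)) inner≡k
    back : ∀ {w} → PairingWith δ (S ∘ embed) k w → PairingWith 0 S k (extend w) × lookup (extend w) a ≡ c
    back {w} (w-pairing , inner≡k) =
      ( extend-isPairing w w-pairing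
      , trans (innerPairs-restrict S (extend w) (extend-isPairing w w-pairing) (extend-a w))
              (trans (cong (λ u → δ + innerPairs (S ∘ embed) (lookup u)) (restrict-extend w)) inner≡k))
      , extend-a w

-- The recurrence

pairingCount-splitAt : ∀ m (S : Fin (suc (suc m)) → Bool) k a →
  pairingCount (suc (suc m)) S k
  ≡ sum (λ c′ → pairingCountFrom m (fromBool (S a ∧ S (punchIn a c′))) (S ∘ RemovePair.embed m a c′) k)
pairingCount-splitAt m S k a = begin
    count P? Vs
  ≡⟨ count-partition (suc (suc m)) (λ v → lookup v a) P? Vs ⟩
    sum (λ c → count (λ v → P? v ×-dec lookup v a Fin.≟ c) Vs)
  ≡⟨ sum-remove {i = a} (λ c → count (λ v → P? v ×-dec lookup v a Fin.≟ c) Vs) ⟩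
      count (λ v → P? v ×-dec lookup v a Fin.≟ a) Vs
    + sum (λ c′ → count (λ v → P? v ×-dec lookup v a Fin.≟ punchIn a c′) Vs)
  ≡⟨ cong₂ _+_ (count-none _ Vs λ v ((v-pairing , _) , v-a) → proj₂ (v-pairing a) v-a)
               (sum-cong-≗ {suc m} λ c′ → RemovePair.pairingCount-partner m a c′ S k) ⟩
    sum (λ c′ → pairingCountFrom m (fromBool (S a ∧ S (punchIn a c′))) (S ∘ RemovePair.embed m a c′) k)
  ∎
  where
  open ≡-Reasoning
  Vs = allVecs (suc (suc m)) (suc (suc m))
  P? = pairingWith? 0 S k

pairingCountFrom-suc : ∀ m (S : Fin m → Bool) k → pairingCountFrom m 1 S (suc k) ≡ pairingCount m S k
pairingCountFrom-suc m S k = count-cong (pairingWith? 1 S (suc k)) (pairingWith? 0 S k) (allVecs m m) λ v →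
  cong (does (isPairing? (lookup v)) ∧_)
    (does-⇔ (mk⇔ suc-injective (cong suc)) (1 + innerPairs S (lookup v) ℕ.≟ suc k) (innerPairs S (lookup v) ℕ.≟ k))

-- The partner of a fixed marked point is one of the s other marked points or one of the b
-- unmarked ones; pairingNumberInner s b k stands for pairingNumber (s ∸ 1) b (k ∸ 1), 0 if k = 0.
pairingNumber      : ℕ → ℕ → ℕ → ℕ
pairingNumberInner : ℕ → ℕ → ℕ → ℕ
pairingNumber zero zero          zero    = 1
pairingNumber zero zero          (suc k) = 0
pairingNumber zero (suc zero)    k       = 0
pairingNumber zero (suc (suc b)) k       = suc b * pairingNumber zero b k
pairingNumber (suc s) b k = s * pairingNumberInner s b k + b * pairingNumber s (pred b) k
pairingNumberInner zero    b k       = 0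
pairingNumberInner (suc s) b zero    = 0
pairingNumberInner (suc s) b (suc k) = pairingNumber s b k

PairingCountFormula : ℕ → Set
PairingCountFormula m = ∀ (S : Fin m → Bool) k b → size S + b ≡ m → pairingCount m S k ≡ pairingNumber (size S) b k

pairingCount-markedStep : ∀ m → PairingCountFormula m → ∀ (S : Fin (suc (suc m)) → Bool) a → S a ≡ true →
  ∀ k b → size S + b ≡ suc (suc m) → pairingCount (suc (suc m)) S k ≡ pairingNumber (size S) b k
pairingCount-markedStep m formula S a Sa≡true k b size+b≡ = begin
    pairingCount (suc (suc m)) S k
  ≡⟨ pairingCount-splitAt m S k a ⟩
    sum (λ c′ → pairingCountFrom m (fromBool (S a ∧ S (punchIn a c′))) (S ∘ RemovePair.embed m a c′) k)
  ≡⟨ sum-cong-≗ {suc m} summand ⟩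
    sum (λ c′ → if S (punchIn a c′) then pairingNumberInner s₀ u k else pairingNumber s₀ (pred u) k)
  ≡⟨ sum-if (suc m) (S ∘ punchIn a) _ _ ⟩
    pairingNumber (suc s₀) u k
  ≡⟨ cong₂ (λ s b → pairingNumber s b k) (sym size≡) u≡b ⟩
    pairingNumber (size S) b k
  ∎
  where
  open ≡-Reasoning
  s₀ = size (S ∘ punchIn a)
  u  = size (not ∘ S ∘ punchIn a)
  size≡ : size S ≡ suc s₀
  size≡ = trans (size-remove S a) (cong (λ Sa → fromBool Sa + s₀) Sa≡true)
  u≡b : u ≡ b
  u≡b = +-cancelˡ-≡ s₀ u b (trans (size+size-not (suc m) (S ∘ punchIn a))
          (suc-injective (trans (sym size+b≡) (cong (_+ b) size≡))))
  summand : ∀ c′ → pairingCountFrom m (fromBool (S a ∧ S (punchIn a c′))) (S ∘ RemovePair.embed m a c′) k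
                 ≡ (if S (punchIn a c′) then pairingNumberInner s₀ u k else pairingNumber s₀ (pred u) k)
  summand c′ rewrite Sa≡true
    with S (punchIn a c′) | size-remove (S ∘ punchIn a) c′ | size-remove (not ∘ S ∘ punchIn a) c′
  ... | true  | s₀≡ | u≡ = trans (marked k) (cong₂ (λ s b → pairingNumberInner s b k) (sym s₀≡) (sym u≡))
    where
    Se = S ∘ RemovePair.embed m a c′
    marked : ∀ k → pairingCountFrom m 1 Se k ≡ pairingNumberInner (suc (size Se)) (size (not ∘ Se)) k
    marked zero     = count-none _ (allVecs m m) λ _ ()
    marked (suc k′) = trans (pairingCountFrom-suc m Se k′) (formula Se k′ _ (size+size-not m Se))
  ... | false | s₀≡ | u≡ = trans (formula Se k _ (size+size-not m Se))
                                 (cong₂ (λ s b → pairingNumber s (pred b) k) (sym s₀≡) (sym u≡))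
    where
    Se = S ∘ RemovePair.embed m a c′

pairingCount-unmarkedStep : ∀ m → PairingCountFormula m → ∀ (S : Fin (suc (suc m)) → Bool) →
  (∀ x → S x ≡ false) →
  ∀ k b → size S + b ≡ suc (suc m) → pairingCount (suc (suc m)) S k ≡ pairingNumber (size S) b k
pairingCount-unmarkedStep m formula S unmarked k b size+b≡ = begin
    pairingCount (suc (suc m)) S k
  ≡⟨ pairingCount-splitAt m S k zero ⟩
    sum (λ c′ → pairingCountFrom m (fromBool (S zero ∧ S (suc c′))) (S ∘ RemovePair.embed m zero c′) k)
  ≡⟨ sum-cong-≗ {suc m} summand ⟩
    sum {suc m} (λ _ → pairingNumber 0 m k)
  ≡⟨ sum-const (suc m) _ ⟩
    pairingNumber 0 (suc (suc m)) k
  ≡⟨ cong₂ (λ s b → pairingNumber s b k) size≡0 (trans (sym (cong (_+ b) size≡0)) size+b≡) ⟨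
    pairingNumber (size S) b k
  ∎
  where
  open ≡-Reasoning
  size≡0 : size S ≡ 0
  size≡0 = size-allFalse _ S unmarked
  summand : ∀ c′ → pairingCountFrom m (fromBool (S zero ∧ S (suc c′))) (S ∘ RemovePair.embed m zero c′) k
                 ≡ pairingNumber 0 m k
  summand c′ rewrite unmarked zero =
    trans (formula Se k m (cong (_+ m) Se≡0)) (cong (λ s → pairingNumber s m k) Se≡0)
    where
    Se = S ∘ RemovePair.embed m zero c′
    Se≡0 : size Se ≡ 0
    Se≡0 = size-allFalse m Se (unmarked ∘ RemovePair.embed m zero c′)

pairingCount≡pairingNumber : ∀ m → PairingCountFormula m
pairingCount≡pairingNumber zero S zero    zero refl = refl
pairingCount≡pairingNumber zero S (suc k) zero refl = refl
pairingCount≡pairingNumber (suc zero) S k b eq with S zero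
pairingCount≡pairingNumber (suc zero) S k zero       refl | true  = refl
pairingCount≡pairingNumber (suc zero) S k (suc zero) refl | false = refl
pairingCount≡pairingNumber (suc (suc m)) S with any? (λ x → S x Data.Bool.≟ true)
... | yes (a , Sa≡true) = pairingCount-markedStep m (pairingCount≡pairingNumber m) S a Sa≡true
... | no  noneMarked    =
  pairingCount-unmarkedStep m (pairingCount≡pairingNumber m) S (λ x → ¬-not (λ Sx → noneMarked (x , Sx)))

-- Closed form and ratio of consecutive terms

pairingNumberInner-zero : ∀ s b → pairingNumberInner s b 0 ≡ 0
pairingNumberInner-zero zero    b = refl
pairingNumberInner-zero (suc s) b = refl

pairingNumber-vanish : ∀ s b k → s < k + k → pairingNumber s b k ≡ 0
pairingNumber-vanish zero zero          (suc k) _ = refl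
pairingNumber-vanish zero (suc zero)    (suc k) _ = refl
pairingNumber-vanish zero (suc (suc b)) (suc k) h =
  trans (cong (suc b *_) (pairingNumber-vanish zero b (suc k) h)) (*-zeroʳ (suc b))
pairingNumber-vanish (suc s) b k h =
  cong₂ _+_ (trans (cong (s *_) (inner s k h)) (*-zeroʳ s))
            (trans (cong (b *_) (pairingNumber-vanish s (pred b) k (<-trans (n<1+n s) h))) (*-zeroʳ b))
  where
  inner : ∀ s k → suc s < k + k → pairingNumberInner s b k ≡ 0
  inner zero    k       _ = refl
  inner (suc s) zero    ()
  inner (suc s) (suc k) (s≤s h) rewrite +-suc k k = pairingNumber-vanish s b k (≤-pred h)

evenDoubleFactorial : ℕ → ℕ
evenDoubleFactorial zero    = 1
evenDoubleFactorial (suc r) = 2 * suc r * evenDoubleFactorial r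

evenDoubleFactorial≢0 : ∀ r → NonZero (evenDoubleFactorial r)
evenDoubleFactorial≢0 zero    = _
evenDoubleFactorial≢0 (suc r) = m*n≢0 (2 * suc r) (evenDoubleFactorial r) {{_}} {{evenDoubleFactorial≢0 r}}

pairingNumber-perfect : ∀ j → pairingNumber 0 (j + j) 0 * evenDoubleFactorial j ≡ (j + j) !
pairingNumber-perfect zero    = refl
pairingNumber-perfect (suc j) rewrite +-suc j j = begin
    suc (j + j) * G * (2 * suc j * D)   ≡⟨ reorder (suc (j + j)) G j D ⟩
    suc (suc (j + j)) * suc (j + j) * (G * D)  ≡⟨ cong (suc (suc (j + j)) * suc (j + j) *_) (pairingNumber-perfect j) ⟩
    suc (suc (j + j)) * suc (j + j) * (j + j) !  ≡⟨ *-assoc (suc (suc (j + j))) (suc (j + j)) ((j + j) !) ⟩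
    suc (suc (j + j)) ! ∎
  where
  open ≡-Reasoning
  G = pairingNumber 0 (j + j) 0
  D = evenDoubleFactorial j
  reorder : ∀ a x j d → a * x * (2 * suc j * d) ≡ suc (suc (j + j)) * a * (x * d)
  reorder = solve-∀

pairingDenominator : ℕ → ℕ → ℕ → ℕ
pairingDenominator k u j = u ! * evenDoubleFactorial k * evenDoubleFactorial j

pairingNumber-closedForm : ∀ s b k u j → s ≡ k + k + u → b ≡ u + (j + j) →
  pairingNumber s b k * pairingDenominator k u j ≡ s ! * b !
closedForm-innerTerm : ∀ s b k u j → suc s ≡ k + k + u → b ≡ u + (j + j) →
  s * pairingNumberInner s b k * pairingDenominator k u j ≡ (k + k) * (s ! * b !)
closedForm-outerTerm : ∀ s b k u j → suc s ≡ k + k + u → b ≡ u + (j + j) →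
  b * pairingNumber s (pred b) k * pairingDenominator k u j ≡ u * (s ! * b !)

pairingNumber-closedForm zero b zero    zero    j refl refl =
  trans (cong (pairingNumber 0 (j + j) 0 *_) (+-identityʳ (evenDoubleFactorial j)))
        (trans (pairingNumber-perfect j) (sym (+-identityʳ _)))
pairingNumber-closedForm zero b zero    (suc u) j () _
pairingNumber-closedForm zero b (suc k) u       j () _
pairingNumber-closedForm (suc s) b k u j s≡ b≡ = begin
    (s * pairingNumberInner s b k + b * pairingNumber s (pred b) k) * W
  ≡⟨ *-distribʳ-+ W (s * pairingNumberInner s b k) _ ⟩
    s * pairingNumberInner s b k * W + b * pairingNumber s (pred b) k * W
  ≡⟨ cong₂ _+_ (closedForm-innerTerm s b k u j s≡ b≡) (closedForm-outerTerm s b k u j s≡ b≡) ⟩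
    (k + k) * (s ! * b !) + u * (s ! * b !)
  ≡⟨ *-distribʳ-+ (s ! * b !) (k + k) u ⟨
    (k + k + u) * (s ! * b !)
  ≡⟨ cong (_* (s ! * b !)) (sym s≡) ⟩
    suc s * (s ! * b !)
  ≡⟨ *-assoc (suc s) (s !) (b !) ⟨
    suc s ! * b !
  ∎
  where
  open ≡-Reasoning
  W = pairingDenominator k u j

closedForm-innerTerm s       b zero    u j _  _  = trans
  (cong (λ x → s * x * pairingDenominator 0 u j) (pairingNumberInner-zero s b))
  (cong (_* pairingDenominator 0 u j) (*-zeroʳ s))
closedForm-innerTerm zero    b (suc k) u j eq _  = ⊥-elim (0≢1+n (trans (suc-injective eq) (cong (_+ u) (+-suc k k))))
closedForm-innerTerm (suc s) b (suc k) u j eq b≡ = begin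
    suc s * pairingNumber s b k * (u ! * (2 * suc k * D) * E)
  ≡⟨ reorder (suc s) (pairingNumber s b k) (u !) k D E ⟩
    2 * suc k * suc s * (pairingNumber s b k * pairingDenominator k u j)
  ≡⟨ cong (2 * suc k * suc s *_) (pairingNumber-closedForm s b k u j s≡ b≡) ⟩
    2 * suc k * suc s * (s ! * b !)
  ≡⟨ regroup (suc k) (suc s) (s !) (b !) ⟩
    (suc k + suc k) * (suc s * s ! * b !)
  ∎
  where
  open ≡-Reasoning
  D = evenDoubleFactorial k
  E = evenDoubleFactorial j
  s≡ : s ≡ k + k + u
  s≡ = suc-injective (suc-injective (trans eq (cong (λ x → suc x + u) (+-suc k k))))
  reorder : ∀ a x f k d e → a * x * (f * (2 * suc k * d) * e) ≡ 2 * suc k * a * (x * (f * d * e))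
  reorder = solve-∀
  regroup : ∀ k a f g → 2 * k * a * (f * g) ≡ (k + k) * (a * f * g)
  regroup = solve-∀

closedForm-outerTerm s b k zero    j eq _    = trans
  (cong (λ x → b * x * pairingDenominator k 0 j)
        (pairingNumber-vanish s (pred b) k (≤-reflexive (trans eq (+-identityʳ _)))))
  (cong (_* pairingDenominator k 0 j) (*-zeroʳ b))
closedForm-outerTerm s _ k (suc u) j eq refl = begin
    suc b * pairingNumber s b k * (suc u * u ! * D * E)
  ≡⟨ reorder (suc b) (pairingNumber s b k) (suc u) (u !) D E ⟩
    suc u * suc b * (pairingNumber s b k * pairingDenominator k u j)
  ≡⟨ cong (suc u * suc b *_) (pairingNumber-closedForm s b k u j (suc-injective (trans eq (+-suc (k + k) u))) refl) ⟩
    suc u * suc b * (s ! * b !)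
  ≡⟨ regroup (suc u) (suc b) (s !) (b !) ⟩
    suc u * (s ! * (suc b * b !))
  ∎
  where
  open ≡-Reasoning
  b = u + (j + j)
  D = evenDoubleFactorial k
  E = evenDoubleFactorial j
  reorder : ∀ b x v f d e → b * x * (v * f * d * e) ≡ v * b * (x * (f * d * e))
  reorder = solve-∀
  regroup : ∀ v b f g → v * b * (f * g) ≡ v * (f * (b * g))
  regroup = solve-∀

pairingNumber-ratio : ∀ k u j → let s = k + k + (u + 2); b = u + 2 + (j + j) in
  pairingNumber s b k * ((u + 2) * (u + 1)) ≡ pairingNumber s b (suc k) * (4 * (suc k * suc j))
pairingNumber-ratio k u j = *-cancelʳ-≡ _ _ (pairingDenominator k u j) {{nonZero}} (begin
    G k * ((u + 2) * (u + 1)) * (u ! * D k * D j)        ≡⟨ absorb (G k) u (u !) (D k) (D j) ⟩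
    G k * ((u + 2) * ((u + 1) * u !) * D k * D j)        ≡⟨ cong (λ f → G k * (f * D k * D j)) (sym (u+2! u)) ⟩
    G k * ((u + 2) ! * D k * D j)                        ≡⟨ pairingNumber-closedForm s b k (u + 2) j refl refl ⟩
    s ! * b !                                            ≡⟨ pairingNumber-closedForm s b (suc k) u (suc j) s≡ b≡ ⟨
    G (suc k) * (u ! * D (suc k) * D (suc j))            ≡⟨ extract (G (suc k)) (u !) k (D k) j (D j) ⟩
    G (suc k) * (4 * (suc k * suc j)) * (u ! * D k * D j) ∎)
  where
  open ≡-Reasoning
  s = k + k + (u + 2)
  b = u + 2 + (j + j)
  G = pairingNumber s b
  D = evenDoubleFactorial
  nonZero : NonZero (u ! * D k * D j)
  nonZero = m*n≢0 (u ! * D k) (D j)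
    {{m*n≢0 (u !) (D k) {{u !≢0}} {{evenDoubleFactorial≢0 k}}}} {{evenDoubleFactorial≢0 j}}
  u+2! : ∀ u → (u + 2) ! ≡ (u + 2) * ((u + 1) * u !)
  u+2! u rewrite +-comm u 2 | +-comm u 1 = refl
  s≡ : s ≡ suc k + suc k + u
  s≡ = rearrange k u
    where
    rearrange : ∀ k u → k + k + (u + 2) ≡ suc k + suc k + u
    rearrange = solve-∀
  b≡ : b ≡ u + (suc j + suc j)
  b≡ = rearrange u j
    where
    rearrange : ∀ u j → u + 2 + (j + j) ≡ u + (suc j + suc j)
    rearrange = solve-∀
  absorb : ∀ g u f d e → g * ((u + 2) * (u + 1)) * (f * d * e) ≡ g * ((u + 2) * ((u + 1) * f) * d * e)
  absorb = solve-∀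
  extract : ∀ g f k d j e → g * (f * (2 * suc k * d) * (2 * suc j * e)) ≡ g * (4 * (suc k * suc j)) * (f * d * e)
  extract = solve-∀

module _ (k u j : ℕ) where

  private
    s = k + k + (u + 2)
    b = u + 2 + (j + j)

  pairingNumber-≤-suc : 4 * (suc k * suc j) ≤ (u + 2) * (u + 1) → pairingNumber s b k ≤ pairingNumber s b (suc k)
  pairingNumber-≤-suc ratio≥1 = *-cancelʳ-≤ _ _ ((u + 2) * (u + 1)) {{nonZero}}
    (≤-trans (≤-reflexive (pairingNumber-ratio k u j)) (*-monoʳ-≤ (pairingNumber s b (suc k)) ratio≥1))
    where
    nonZero : NonZero ((u + 2) * (u + 1))
    nonZero = m*n≢0 (u + 2) (u + 1) {{>-nonZero (≤-trans (s≤s z≤n) (m≤n+m 2 u))}} {{>-nonZero (m≤n+m 1 u)}}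

  pairingNumber-suc-≤ : (u + 2) * (u + 1) ≤ 4 * (suc k * suc j) → pairingNumber s b (suc k) ≤ pairingNumber s b k
  pairingNumber-suc-≤ ratio≤1 = *-cancelʳ-≤ _ _ (4 * (suc k * suc j)) {{nonZero}}
    (≤-trans (≤-reflexive (sym (pairingNumber-ratio k u j))) (*-monoʳ-≤ (pairingNumber s b k) ratio≤1))
    where
    nonZero : NonZero (4 * (suc k * suc j))
    nonZero = m*n≢0 4 (suc k * suc j) {{_}} {{m*n≢0 (suc k) (suc j)}}

module _ {s b h k : ℕ} (s+b≡2h : s + b ≡ h * 2) where

  -- At k marked pairs there are u + 2 mixed pairs and j unmarked pairs.
  pairShape : 2 * suc k ≤ s → s ≤ h + k → ∃ λ u → ∃ λ j → s ≡ k + k + (u + 2) × b ≡ u + 2 + (j + j)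
  pairShape 2+2k≤s s≤h+k = u , j , s≡ , b≡
    where
    2+2k+u≡s = m≤n⇒∃[o]m+o≡n 2+2k≤s
    s+j≡h+k  = m≤n⇒∃[o]m+o≡n s≤h+k
    u = proj₁ 2+2k+u≡s
    j = proj₁ s+j≡h+k
    s≡ : s ≡ k + k + (u + 2)
    s≡ = trans (sym (proj₂ 2+2k+u≡s)) (rearrange k u)
      where
      rearrange : ∀ k u → 2 * suc k + u ≡ k + k + (u + 2)
      rearrange = solve-∀
    h≡ : h ≡ k + (u + 2) + j
    h≡ = +-cancelˡ-≡ k h _ (trans (+-comm k h) (trans (sym (proj₂ s+j≡h+k))
           (trans (cong (_+ j) s≡) (rearrange k u j))))
      where
      rearrange : ∀ k u j → k + k + (u + 2) + j ≡ k + (k + (u + 2) + j)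
      rearrange = solve-∀
    b≡ : b ≡ u + 2 + (j + j)
    b≡ = +-cancelˡ-≡ s b _ (begin
        s + b                     ≡⟨ s+b≡2h ⟩
        h * 2                     ≡⟨ cong (_* 2) h≡ ⟩
        (k + (u + 2) + j) * 2     ≡⟨ rearrange k u j ⟩
        k + k + (u + 2) + (u + 2 + (j + j)) ≡⟨ cong (_+ (u + 2 + (j + j))) s≡ ⟨
        s + (u + 2 + (j + j))     ∎)
      where
      open ≡-Reasoning
      rearrange : ∀ k u j → (k + (u + 2) + j) * 2 ≡ k + k + (u + 2) + (u + 2 + (j + j))
      rearrange = solve-∀

shape-pred : ∀ k u → pred (k + k + (u + 2)) ≡ k + k + (u + 1)
shape-pred k u rewrite +-comm u 2 | +-comm u 1 | +-suc (k + k) (suc u) = refl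

shape-sum : ∀ {r} k u j → k + k + (u + 2) + (u + 2 + (j + j)) ≡ suc (suc r) → suc r ≡ k + k + u + u + j + j + 3
shape-sum k u j eq = suc-injective (trans (sym eq) (rearrange k u j))
  where
  rearrange : ∀ k u j → k + k + (u + 2) + (u + 2 + (j + j)) ≡ suc (k + k + u + u + j + j + 3)
  rearrange = solve-∀

shape-square : ∀ k u → (k + k + (u + 2)) * (k + k + (u + 1)) ≡ (u + 2) * (u + 1) + (k + k) * (k + k + u + u + 3)
shape-square = solve-∀

pairingNumber-increasing : ∀ {s b r h k} → s + b ≡ suc (suc r) → s + b ≡ h * 2 → s ≤ h + k →
  2 * (suc k * suc r) ≤ s * pred s → pairingNumber s b k ≤ pairingNumber s b (suc k)
pairingNumber-increasing {s} {b} {r} {h} {k} s+b≡ s+b≡2h s≤h+k above with pairShape s+b≡2h 2+2k≤s s≤h+k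
  where
  2+2k≤s : 2 * suc k ≤ s
  2+2k≤s = *-cancelʳ-≤ (2 * suc k) s (suc r) (begin
      2 * suc k * suc r ≡⟨ *-assoc 2 (suc k) (suc r) ⟩
      2 * (suc k * suc r) ≤⟨ above ⟩
      s * pred s ≤⟨ *-monoʳ-≤ s (pred-mono-≤ (subst (s ≤_) s+b≡ (m≤m+n s b))) ⟩
      s * suc r ∎)
    where open ≤-Reasoning
... | u , j , refl , refl =
  pairingNumber-≤-suc k u j (m+n≤o⇒m≤o _ (+-cancelʳ-≤ ((k + k) * (k + k + u + u + 3)) _ _ (begin
    4 * (suc k * suc j) + (4 * u + 2) + (k + k) * (k + k + u + u + 3) ≡⟨ expand k u j ⟨
    2 * (suc k * (k + k + u + u + j + j + 3))                         ≡⟨ cong (λ q → 2 * (suc k * q)) (shape-sum k u j s+b≡) ⟨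
    2 * (suc k * suc r)                                               ≤⟨ above ⟩
    (k + k + (u + 2)) * pred (k + k + (u + 2))                        ≡⟨ cong ((k + k + (u + 2)) *_) (shape-pred k u) ⟩
    (k + k + (u + 2)) * (k + k + (u + 1))                             ≡⟨ shape-square k u ⟩
    (u + 2) * (u + 1) + (k + k) * (k + k + u + u + 3)                 ∎)))
  where
  open ≤-Reasoning
  expand : ∀ k u j → 2 * (suc k * (k + k + u + u + j + j + 3))
                   ≡ 4 * (suc k * suc j) + (4 * u + 2) + (k + k) * (k + k + u + u + 3)
  expand = solve-∀

-- If s > h + k then s(s − 1) ≥ (h + k + 1)(h + k) > 2k(2h − 1).
marked≤half+k : ∀ {s b r h k} → s + b ≡ suc (suc r) → s + b ≡ h * 2 →
  s * pred s ≤ 2 * (k * suc r) → s ≤ h + k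
marked≤half+k {s} {b} {r} {h} {k} s+b≡ s+b≡2h below with s ≤? h + k
... | yes s≤h+k = s≤h+k
... | no  s≰h+k = ⊥-elim (<-irrefl refl (begin-strict
    2 * (k * suc r)                                      <⟨ s≤s (m≤m+n _ excess) ⟩
    suc (2 * (k * suc r) + excess)                       ≡⟨ cong (λ r → suc (2 * (k * suc r) + excess)) r≡ ⟩
    suc (2 * (k * suc ((k + e + f) * 2)) + excess)       ≡⟨ expand k e f ⟨
    (suc (suc (k + e + f) + k) + e) * (suc (k + e + f) + k + e) ≡⟨ cong (λ x → x * pred x) s≡ ⟨
    s * pred s                                           ≤⟨ below ⟩
    2 * (k * suc r)                                      ∎))
  where
  open ≤-Reasoning
  h+k+1+e≡s = m≤n⇒∃[o]m+o≡n (≰⇒> s≰h+k)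
  s+f≡2h    = m≤n⇒∃[o]m+o≡n (subst (s ≤_) s+b≡2h (m≤m+n s b))
  e = proj₁ h+k+1+e≡s
  f = proj₁ s+f≡2h
  h≡ : h ≡ suc (k + e + f)
  h≡ = sym (+-cancelˡ-≡ h _ _ (begin-equality
      h + suc (k + e + f)       ≡⟨ rearrange h k e f ⟩
      suc (h + k) + e + f       ≡⟨ cong (_+ f) (proj₂ h+k+1+e≡s) ⟩
      s + f                     ≡⟨ proj₂ s+f≡2h ⟩
      h * 2                     ≡⟨ *-comm h 2 ⟩
      h + (h + 0)               ≡⟨ cong (h +_) (+-identityʳ h) ⟩
      h + h                     ∎))
    where
    rearrange : ∀ h k e f → h + suc (k + e + f) ≡ suc (h + k) + e + f
    rearrange = solve-∀
  s≡ : s ≡ suc (suc (k + e + f) + k) + e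
  s≡ = trans (sym (proj₂ h+k+1+e≡s)) (cong (λ h → suc (h + k) + e) h≡)
  r≡ : r ≡ (k + e + f) * 2
  r≡ = suc-injective (suc-injective (trans (sym s+b≡) (trans s+b≡2h (cong (_* 2) h≡))))
  excess = 4 * k * (e + 1) + (e + e + f) * (e + e + f + 3) + 1
  expand : ∀ k e f → (suc (suc (k + e + f) + k) + e) * (suc (k + e + f) + k + e)
                   ≡ suc (2 * (k * suc ((k + e + f) * 2)) + (4 * k * (e + 1) + (e + e + f) * (e + e + f + 3) + 1))
  expand = solve-∀

pairingNumber-decreasing : ∀ {s b r h k} → s + b ≡ suc (suc r) → s + b ≡ h * 2 → 2 * suc k ≤ s →
  s * pred s ≤ 2 * (k * suc r) → pairingNumber s b (suc k) ≤ pairingNumber s b k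
pairingNumber-decreasing {s} {b} {r} {h} {k} s+b≡ s+b≡2h 2+2k≤s below
  with pairShape {k = k} s+b≡2h 2+2k≤s (marked≤half+k {h = h} {k = k} s+b≡ s+b≡2h below)
... | u , j , refl , refl = pairingNumber-suc-≤ k u j (begin
    (u + 2) * (u + 1)     ≤⟨ +-cancelʳ-≤ ((k + k) * (k + k + u + u + 3)) _ _ (begin
        (u + 2) * (u + 1) + (k + k) * (k + k + u + u + 3) ≡⟨ shape-square k u ⟨
        (k + k + (u + 2)) * (k + k + (u + 1))             ≡⟨ cong ((k + k + (u + 2)) *_) (shape-pred k u) ⟨
        (k + k + (u + 2)) * pred (k + k + (u + 2))        ≤⟨ below ⟩
        2 * (k * suc r)                                   ≡⟨ cong (λ q → 2 * (k * q)) (shape-sum k u j s+b≡) ⟩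
        2 * (k * (k + k + u + u + j + j + 3))             ≡⟨ expand k u j ⟩
        4 * (k * j) + (k + k) * (k + k + u + u + 3)       ∎) ⟩
    4 * (k * j)           ≤⟨ *-monoʳ-≤ 4 (*-mono-≤ (n≤1+n k) (n≤1+n j)) ⟩
    4 * (suc k * suc j)   ∎)
  where
  open ≤-Reasoning
  expand : ∀ k u j → 2 * (k * (k + k + u + u + j + j + 3)) ≡ 4 * (k * j) + (k + k) * (k + k + u + u + 3)
  expand = solve-∀

sumℕ : ℕ → (ℕ → ℕ) → ℕ
sumℕ zero    f = 0
sumℕ (suc N) f = f 0 + sumℕ N (f ∘ suc)

sum-toℕ : ∀ N (f : ℕ → ℕ) → sum {N} (f ∘ toℕ) ≡ sumℕ N f
sum-toℕ zero    f = refl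
sum-toℕ (suc N) f = cong (f 0 +_) (sum-toℕ N (f ∘ suc))

sumℕ-+ : ∀ M N f → sumℕ (M + N) f ≡ sumℕ M f + sumℕ N (λ y → f (M + y))
sumℕ-+ zero    N f = refl
sumℕ-+ (suc M) N f = trans (cong (f 0 +_) (sumℕ-+ M N (f ∘ suc))) (sym (+-assoc (f 0) _ _))

sumℕ-cong : ∀ N {f g : ℕ → ℕ} → (∀ x → x < N → f x ≡ g x) → sumℕ N f ≡ sumℕ N g
sumℕ-cong zero    eq = refl
sumℕ-cong (suc N) eq = cong₂ _+_ (eq 0 (s≤s z≤n)) (sumℕ-cong N (λ x x<N → eq (suc x) (s≤s x<N)))

sumℕ-const : ∀ N c → sumℕ N (λ _ → c) ≡ N * c
sumℕ-const zero    c = refl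
sumℕ-const (suc N) c = cong (c +_) (sumℕ-const N c)

any?-cong : ∀ {n} {P Q : Fin n → Set} (P? : Decidable P) (Q? : Decidable Q) →
  (∀ i → does (P? i) ≡ does (Q? i)) → does (any? P?) ≡ does (any? Q?)
any?-cong {zero}  P? Q? eq = refl
any?-cong {suc n} P? Q? eq = cong₂ _∨_ (eq zero) (any?-cong (P? ∘ suc) (Q? ∘ suc) (eq ∘ suc))

any?-none : ∀ {n} {P : Fin n → Set} (P? : Decidable P) → (∀ i → ¬ P i) → does (any? P?) ≡ false
any?-none {zero}  P? ¬P = refl
any?-none {suc n} P? ¬P rewrite dec-false (P? zero) (¬P zero) = any?-none (P? ∘ suc) (¬P ∘ suc)

inCells? : ∀ d n (I : Subset n) x → Dec (Σ (Fin n) λ i → i ∈ˢ I × InCell d (toℕ i) x)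
inCells? d n I x = any? (λ i → (i ∈? I) ×-dec ((d * toℕ i ≤? x) ×-dec (x <? d * suc (toℕ i))))

inCells?-first : ∀ d {n} b (I : Subset n) x → x < d → does (inCells? d (suc n) (b ∷ I) x) ≡ b
inCells?-first d b I x x<d = trans (cong₂ _∨_ firstCell (any?-none _ laterCell)) (∨-identityʳ b)
  where
  does-zero∈? : ∀ b → does (zero ∈? (b ∷ I)) ≡ b
  does-zero∈? true  = refl
  does-zero∈? false = refl
  firstCell : does ((zero ∈? (b ∷ I)) ×-dec ((d * 0 ≤? x) ×-dec (x <? d * 1))) ≡ b
  firstCell rewrite dec-true (d * 0 ≤? x) (subst (_≤ x) (sym (*-zeroʳ d)) z≤n)
                  | dec-true (x <? d * 1) (subst (x <_) (sym (*-identityʳ d)) x<d) = trans (∧-identityʳ _) (does-zero∈? b)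
  laterCell : ∀ i → ¬ ((suc i ∈ˢ b ∷ I) × (d * suc (toℕ i) ≤ x) × (x < d * suc (suc (toℕ i))))
  laterCell i (_ , d+di≤x , _) = <-irrefl refl (<-≤-trans x<d (≤-trans (m≤m*n d (suc (toℕ i))) d+di≤x))

inCells?-shift : ∀ d {n} b (I : Subset n) y → does (inCells? d (suc n) (b ∷ I) (d + y)) ≡ does (inCells? d n I y)
inCells?-shift d b I y = cong₂ _∨_ firstCell (any?-cong later? now? laterCell)
  where
  firstCell : does ((zero ∈? (b ∷ I)) ×-dec ((d * 0 ≤? d + y) ×-dec (d + y <? d * 1))) ≡ false
  firstCell rewrite dec-false (d + y <? d * 1)
                      (λ lt → <-irrefl refl (<-≤-trans (subst (d + y <_) (*-identityʳ d) lt) (m≤m+n d y)))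
    = trans (cong (does (zero ∈? (b ∷ I)) ∧_) (∧-zeroʳ _)) (∧-zeroʳ _)
  later? = λ i → (suc i ∈? (b ∷ I)) ×-dec ((d * suc (toℕ i) ≤? d + y) ×-dec (d + y <? d * suc (suc (toℕ i))))
  now?   = λ i → (i ∈? I) ×-dec ((d * toℕ i ≤? y) ×-dec (y <? d * suc (toℕ i)))
  laterCell : ∀ i → does (later? i) ≡ does (now? i)
  laterCell i = cong₂ (λ lo hi → does (i ∈? I) ∧ (lo ∧ hi))
    (does-⇔ (mk⇔ (λ le → +-cancelˡ-≤ d _ _ (subst (_≤ d + y) (*-suc d (toℕ i)) le))
                 (λ le → subst (_≤ d + y) (sym (*-suc d (toℕ i))) (+-monoʳ-≤ d le)))
             (d * suc (toℕ i) ≤? d + y) (d * toℕ i ≤? y))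
    (does-⇔ (mk⇔ (λ lt → +-cancelˡ-≤ d _ _ (subst₂ _≤_ (sym (+-suc d y)) (*-suc d (suc (toℕ i))) lt))
                 (λ lt → subst₂ _≤_ (+-suc d y) (sym (*-suc d (suc (toℕ i)))) (+-monoʳ-≤ d lt)))
             (d + y <? d * suc (suc (toℕ i))) (y <? d * suc (toℕ i)))

sumℕ-inCells : ∀ d n (I : Subset n) → sumℕ (d * n) (fromBool ∘ does ∘ inCells? d n I) ≡ d * ∣ I ∣
sumℕ-inCells d zero    []      rewrite *-zeroʳ d = refl
sumℕ-inCells d (suc n) (b ∷ I) = begin
    sumℕ (d * suc n) f
  ≡⟨ cong (λ N → sumℕ N f) (*-suc d n) ⟩
    sumℕ (d + d * n) f
  ≡⟨ sumℕ-+ d (d * n) f ⟩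
    sumℕ d f + sumℕ (d * n) (λ y → f (d + y))
  ≡⟨ cong₂ _+_ (trans (sumℕ-cong d λ x x<d → cong fromBool (inCells?-first d b I x x<d)) (sumℕ-const d (fromBool b)))
               (trans (sumℕ-cong (d * n) λ y _ → cong fromBool (inCells?-shift d b I y)) (sumℕ-inCells d n I)) ⟩
    d * fromBool b + d * ∣ I ∣
  ≡⟨ *-distribˡ-+ d (fromBool b) ∣ I ∣ ⟨
    d * (fromBool b + ∣ I ∣)
  ≡⟨ cong (d *_) (∣b∷I∣ b) ⟩
    d * ∣ b ∷ I ∣
  ∎
  where
  open ≡-Reasoning
  f = fromBool ∘ does ∘ inCells? d (suc n) (b ∷ I)
  ∣b∷I∣ : ∀ b → fromBool b + ∣ I ∣ ≡ ∣ b ∷ I ∣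
  ∣b∷I∣ true  = refl
  ∣b∷I∣ false = refl

X≡innerPairs : ∀ d n (I : Subset n) p → X d n I p ≡ innerPairs (does ∘ inT? d n I) p
X≡innerPairs d n I p = trans (length-filter≡count _ (allFin (d * n))) (count-allFin (d * n) _)

cardC≡pairingCount : ∀ d n (I : Subset n) k → cardC d n I k ≡ pairingCount (d * n) (does ∘ inT? d n I) k
cardC≡pairingCount d n I k =
  trans (length-filter-filter≡count (λ v → isPairing? (lookup v)) (λ v → X d n I (lookup v) ℕ.≟ k)
                                    (allVecs (d * n) (d * n)))
        (count-cong _ (pairingWith? 0 (does ∘ inT? d n I) k) (allVecs (d * n) (d * n))
          λ v → cong (λ x → does (isPairing? (lookup v)) ∧ does (x ℕ.≟ k)) (X≡innerPairs d n I (lookup v)))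

size-inT : ∀ d n (I : Subset n) → size (does ∘ inT? d n I) ≡ d * ∣ I ∣
size-inT d n I = trans (sum-toℕ (d * n) (fromBool ∘ does ∘ inCells? d n I)) (sumℕ-inCells d n I)

cardC≡pairingNumber : ∀ d n (I : Subset n) k → cardC d n I k ≡ pairingNumber (d * ∣ I ∣) (d * n ∸ d * ∣ I ∣) k
cardC≡pairingNumber d n I k = begin
    cardC d n I k                     ≡⟨ cardC≡pairingCount d n I k ⟩
    pairingCount (d * n) S k          ≡⟨ pairingCount≡pairingNumber (d * n) S k b size+b≡dn ⟩
    pairingNumber (size S) b k        ≡⟨ cong (λ s → pairingNumber s b k) (size-inT d n I) ⟩
    pairingNumber (d * ∣ I ∣) b k     ∎
  where
  open ≡-Reasoning
  S = does ∘ inT? d n I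
  b = d * n ∸ d * ∣ I ∣
  size+b≡dn : size S + b ≡ d * n
  size+b≡dn = trans (cong (_+ b) (size-inT d n I)) (m+[n∸m]≡n (*-monoʳ-≤ d (∣p∣≤n I)))

2*nC2≡n*pred[n] : ∀ n → 2 * (n C 2) ≡ n * pred n
2*nC2≡n*pred[n] zero    = refl
2*nC2≡n*pred[n] (suc n) = begin
    2 * (suc n C 2)        ≡⟨ cong (2 *_) (nCk+nC[k+1]≡[n+1]C[k+1] n 1) ⟨
    2 * (n C 1 + n C 2)    ≡⟨ cong (λ x → 2 * (x + n C 2)) (nC1≡n n) ⟩
    2 * (n + n C 2)        ≡⟨ *-distribˡ-+ 2 n (n C 2) ⟩
    2 * n + 2 * (n C 2)    ≡⟨ cong (2 * n +_) (2*nC2≡n*pred[n] n) ⟩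
    2 * n + n * pred n     ≡⟨ lemma n ⟩
    suc n * n              ∎
  where
  open ≡-Reasoning
  lemma : ∀ n → 2 * n + n * pred n ≡ suc n * n
  lemma zero    = refl
  lemma (suc n) = expand n
    where
    expand : ∀ n → 2 * suc n + suc n * n ≡ suc (suc n) * suc n
    expand = solve-∀

m≤n/o⇒m*o≤n : ∀ m n o .{{_ : NonZero o}} → m ≤ n / o → m * o ≤ n
m≤n/o⇒m*o≤n m n o m≤n/o = ≤-trans (*-monoˡ-≤ o m≤n/o) (m/n*n≤m n o)

[m+o]/[1+o]≤n⇒m≤n*[1+o] : ∀ m n o → (m + o) / suc o ≤ n → m ≤ n * suc o
[m+o]/[1+o]≤n⇒m≤n*[1+o] m n o ceil≤n with m ≤? n * suc o
... | yes m≤ = m≤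
... | no  m≰ = ⊥-elim (1+n≰n (begin
    suc n                   ≡⟨ m*n/n≡m (suc n) (suc o) ⟨
    suc n * suc o / suc o   ≤⟨ /-monoˡ-≤ (suc o) (begin
        suc n * suc o       ≡⟨ +-suc o (n * suc o) ⟨
        o + suc (n * suc o) ≤⟨ +-monoʳ-≤ o (≰⇒> m≰) ⟩
        o + m               ≡⟨ +-comm o m ⟩
        m + o               ∎) ⟩
    (m + o) / suc o         ≤⟨ ceil≤n ⟩
    n                       ∎))
  where open ≤-Reasoning

lemma3p4 : (n d : ℕ) → 0 < n → 0 < d → 2 ∣ d * n → (I : Subset n) →
    ((k : ℕ) → (d * ∣ I ∣ ∸ (d * n) / 2) ≤ k → suc k ≤ floorE d n ∣ I ∣ →
      cardC d n I k ≤ cardC d n I (suc k))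
    × ((k : ℕ) → ceilE d n ∣ I ∣ ≤ k → suc k ≤ (d * ∣ I ∣) / 2 →
      cardC d n I (suc k) ≤ cardC d n I k)
lemma3p4 (suc _) (suc _) _ _ (divides zero ()) I
lemma3p4 n@(suc _) d@(suc _) _ _ (divides h@(suc _) N≡h*2) I = increasing , decreasing
  where
  N = d * n
  s = d * ∣ I ∣
  b = N ∸ s
  r = N ∸ 2
  s+b≡N : s + b ≡ N
  s+b≡N = m+[n∸m]≡n (*-monoʳ-≤ d (∣p∣≤n I))
  card≡ = cardC≡pairingNumber d n I
  s+b≡h*2 : s + b ≡ h * 2
  s+b≡h*2 = trans s+b≡N N≡h*2
  s+b≡2+r : s + b ≡ suc (suc r)
  s+b≡2+r = trans s+b≡N (sym (m+[n∸m]≡n (subst (2 ≤_) (sym N≡h*2) (s≤s (s≤s z≤n)))))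
  N/2≡h : N / 2 ≡ h
  N/2≡h = trans (/-congˡ {o = 2} N≡h*2) (m*n/n≡m h 2)
  increasing : ∀ k → s ∸ N / 2 ≤ k → suc k ≤ (s C 2) / suc r → cardC d n I k ≤ cardC d n I (suc k)
  increasing k s∸N/2≤k 1+k≤⌊E⌋ rewrite card≡ k | card≡ (suc k) =
    pairingNumber-increasing {h = h} s+b≡2+r s+b≡h*2
      (≤-trans (m≤n+m∸n s h) (+-monoʳ-≤ h (subst (λ x → s ∸ x ≤ k) N/2≡h s∸N/2≤k)))
      (≤-trans (*-monoʳ-≤ 2 (m≤n/o⇒m*o≤n (suc k) (s C 2) (suc r) 1+k≤⌊E⌋))
               (≤-reflexive (2*nC2≡n*pred[n] s)))
  decreasing : ∀ k → ((s C 2) + r) / suc r ≤ k → suc k ≤ s / 2 → cardC d n I (suc k) ≤ cardC d n I k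
  decreasing k ⌈E⌉≤k 1+k≤s/2 rewrite card≡ k | card≡ (suc k) =
    pairingNumber-decreasing {h = h} s+b≡2+r s+b≡h*2
      (subst (_≤ s) (*-comm (suc k) 2) (m≤n/o⇒m*o≤n (suc k) s 2 1+k≤s/2))
      (≤-trans (≤-reflexive (sym (2*nC2≡n*pred[n] s)))
               (*-monoʳ-≤ 2 ([m+o]/[1+o]≤n⇒m≤n*[1+o] (s C 2) k r ⌈E⌉≤k)))
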